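{- $\mathsf{CtoB}$ commutes with addition, multiplication, and exponentiation with base $\omega$.
   Context: $\mathsf{Cnf}$ is the type of Cantor normal forms: binary trees built from $0$ (leaf) and $\omega^a+b$ (node with left subtree $a$, right subtree $b$) such that for every node $\omega^s+t$ contained in the tree, the left subtree of $t$ (or $0$ if $t=0$) is $\le s$ in the lexicographic order. On $\mathsf{Cnf}$, addition is $0+b=b$, $a+0=a$, $(\omega^a+c)+(\omega^b+d)=\omega^b+d$ if $a<b$ and $\omega^a+(c+(\omega^b+d))$ otherwise; multiplication is $0\cdot b=0$, $a\cdot 0=0$, $a\cdot(\omega^0+d)=a+a\cdot d$, $(\omega^a+c)\cdot(\omega^b+d)=\omega^{a+b}+0+(\omega^a+c)\cdot d$ if $b\ne0$; exponentiation with base $\omega$ sends $a$ to $\omega^a+0$. $\mathsf{Brw}$ is the quotient inductive-inductive type of Brouwer trees (constructors $\mathsf{zero}$, $\mathsf{succ}$, $\mathsf{limit}$ of strictly increasing sequences, with bisimilar sequences having equal limits), with addition, multiplication and exponentiation defined by recursion on the second argument ($x+\mathsf{zero}=x$, $x+\mathsf{succ}\,y=\mathsf{succ}(x+y)$, $x+\mathsf{limit}\,f=\mathsf{limit}(\lambda k.\,x+f\,k)$, and analogously for multiplication and exponentiation), and $\omega := \mathsf{limit}\,\iota$ where $\iota:\mathbb N\to\mathsf{Brw}$ embeds the finite trees. The map $\mathsf{CtoB}:\mathsf{Cnf}\to\mathsf{Brw}$ is defined by $\mathsf{CtoB}(0)=\mathsf{zero}$ and $\mathsf{CtoB}(\omega^a+b)=\omega^{\mathsf{CtoB}(a)}+\mathsf{CtoB}(b)$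 (Brouwer-tree exponentiation and addition on the right). -}

module Defs where

open import Data.Nat as ℕ using (ℕ)
open import Data.Product using (Σ; _×_; _,_)
open import Data.Sum using (_⊎_)
open import Relation.Binary.PropositionalEquality using (_≡_)
open import Relation.Nullary using (Dec; yes; no)

data Tree : Set where
  𝟎    : Tree
  ω^_+_ : Tree → Tree → Tree

infixr 30 ω^_+_

data _<ᵀ_ : Tree → Tree → Set where
  <₁ : ∀ {a b} → 𝟎 <ᵀ ω^ a + b
  <₂ : ∀ {a b c d} → a <ᵀ c → ω^ a + b <ᵀ ω^ c + d
  <₃ : ∀ {a b c d} → a ≡ c → b <ᵀ d → ω^ a + b <ᵀ ω^ c + d

_≤ᵀ_ : Tree → Tree → Set
a ≤ᵀ b = (a <ᵀ b) ⊎ (a ≡ b)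

left : Tree → Tree
left 𝟎 = 𝟎
left (ω^ a + _) = a

data isCnf : Tree → Set where
  cnf𝟎 : isCnf 𝟎
  cnfω : ∀ {s t} → isCnf s → isCnf t → left t ≤ᵀ s → isCnf (ω^ s + t)

Cnf : Set
Cnf = Σ Tree isCnf

private
  node-inj₁ : ∀ {a b c d} → ω^ a + b ≡ ω^ c + d → a ≡ c
  node-inj₁ _≡_.refl = _≡_.refl

  node-inj₂ : ∀ {a b c d} → ω^ a + b ≡ ω^ c + d → b ≡ d
  node-inj₂ _≡_.refl = _≡_.refl

_≟ᵀ_ : (a b : Tree) → Dec (a ≡ b)
𝟎 ≟ᵀ 𝟎 = yes _≡_.refl
𝟎 ≟ᵀ (ω^ _ + _) = no (λ ())
(ω^ _ + _) ≟ᵀ 𝟎 = no (λ ())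
(ω^ a + b) ≟ᵀ (ω^ c + d) with a ≟ᵀ c | b ≟ᵀ d
... | yes _≡_.refl | yes _≡_.refl = yes _≡_.refl
... | no a≢c | _ = no (λ e → a≢c (node-inj₁ e))
... | yes _ | no b≢d = no (λ e → b≢d (node-inj₂ e))

_<ᵀ?_ : (a b : Tree) → Dec (a <ᵀ b)
_ <ᵀ? 𝟎 = no (λ ())
𝟎 <ᵀ? (ω^ _ + _) = yes <₁
(ω^ a + b) <ᵀ? (ω^ c + d) with a <ᵀ? c
... | yes p = yes (<₂ p)
... | no ¬p with a ≟ᵀ c
...   | no a≢c = no λ { (<₂ q) → ¬p q ; (<₃ e _) → a≢c e }
...   | yes e with b <ᵀ? d
...     | yes q = yes (<₃ e q)
...     | no ¬q = no λ { (<₂ q) → ¬p q ; (<₃ _ q) → ¬q q }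

infixl 6 _⊕_
_⊕_ : Tree → Tree → Tree
𝟎 ⊕ b = b
(ω^ a + c) ⊕ 𝟎 = ω^ a + c
(ω^ a + c) ⊕ (ω^ b + d) with a <ᵀ? b
... | yes _ = ω^ b + d
... | no _ = ω^ a + (c ⊕ (ω^ b + d))

infixl 7 _⊗_
_⊗_ : Tree → Tree → Tree
𝟎 ⊗ b = 𝟎
(ω^ a + c) ⊗ 𝟎 = 𝟎
(ω^ a + c) ⊗ (ω^ 𝟎 + d) = (ω^ a + c) ⊕ ((ω^ a + c) ⊗ d)
(ω^ a + c) ⊗ (ω^ (ω^ b₁ + b₂) + d) =
  (ω^ (a ⊕ (ω^ b₁ + b₂)) + 𝟎) ⊕ ((ω^ a + c) ⊗ d)

ω^ᶜ : Tree → Tree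
ω^ᶜ a = ω^ a + 𝟎

-- We use plain Brouwer trees and the usual inductively defined order;
-- the equality of the QIIT Brw is rendered as the equivalence
-- x ≈ y := x ≤ y × y ≤ x (Brw's ≤ is antisymmetric, and its path
-- constructor identifies limits of bisimilar sequences, which are
-- exactly the limits that are ≤ each other).
data Brw : Set where
  zero  : Brw
  succ  : Brw → Brw
  limit : (ℕ → Brw) → Brw

infix 4 _≤_ _≈_
data _≤_ : Brw → Brw → Set where
  ≤-zero     : ∀ {x} → zero ≤ x
  ≤-trans    : ∀ {x y z} → x ≤ y → y ≤ z → x ≤ z
  ≤-succ-mono : ∀ {x y} → x ≤ y → succ x ≤ succ y
  ≤-cocone   : ∀ {x f} k → x ≤ f k → x ≤ limit f
  ≤-limiting : ∀ {f x} → (∀ k → f k ≤ x) → limit f ≤ x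

_≈_ : Brw → Brw → Set
x ≈ y = (x ≤ y) × (y ≤ x)

infixl 6 _+_
_+_ : Brw → Brw → Brw
x + zero = x
x + succ y = succ (x + y)
x + limit f = limit (λ k → x + f k)

infixl 7 _*_
_*_ : Brw → Brw → Brw
x * zero = zero
x * succ y = (x * y) + x
x * limit f = limit (λ k → x * f k)

infixr 8 _^_
_^_ : Brw → Brw → Brw
x ^ zero = succ zero
x ^ succ y = (x ^ y) * x
x ^ limit f = limit (λ k → x ^ f k)

ι : ℕ → Brw
ι ℕ.zero = zero
ι (ℕ.suc n) = succ (ι n)

ω : Brw
ω = limit ι

CtoB : Tree → Brw
CtoB 𝟎 = zero
CtoB (ω^ a + b) = (ω ^ CtoB a) + CtoB b

-- A Cantor normal form ω^a + c is bounded by ω^A · n (capitals denote images under CtoB),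
-- and A + 1 ≤ B makes ω^A · n absorbed by ω^B on the left.  Hence, whenever a < b,
-- CtoB (ω^a + c) + ω^B ≈ ω^B, which is exactly the clause of Cnf addition that drops its
-- left summand.  Multiplication reduces to ω^(A + B) ≈ (ω^A + C) · ω^B for B ≥ 1, which
-- holds for the same reason.  The bound needs CtoB to be monotone on exponents, and
-- monotonicity needs the bound, so the two are proved by simultaneous induction.
module Submission where

open import Defs
open import Data.Empty using (⊥-elim)
open import Data.Nat as ℕ using (ℕ)
open import Data.Product using (∃-syntax; _×_; _,_; proj₁; proj₂)
open import Data.Sum using (_⊎_; inj₁; inj₂)
open import Relation.Binary.Bundles using (Preorder)
open import Relation.Binary.PropositionalEquality using (_≡_; refl; sym; trans; cong; subst)
open import Relation.Binary.Structures using (IsEquivalence; IsPreorder)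
open import Relation.Nullary using (¬_; yes; no)

≤-refl : ∀ {x} → x ≤ x
≤-refl {zero}    = ≤-zero
≤-refl {succ x}  = ≤-succ-mono ≤-refl
≤-refl {limit f} = ≤-limiting (λ k → ≤-cocone k ≤-refl)

≤-reflexive : ∀ {x y} → x ≡ y → x ≤ y
≤-reflexive refl = ≤-refl

≈-refl : ∀ {x} → x ≈ x
≈-refl = ≤-refl , ≤-refl

≈-sym : ∀ {x y} → x ≈ y → y ≈ x
≈-sym (x≤y , y≤x) = y≤x , x≤y

≈-trans : ∀ {x y z} → x ≈ y → y ≈ z → x ≈ z
≈-trans (x≤y , y≤x) (y≤z , z≤y) = ≤-trans x≤y y≤z , ≤-trans z≤y y≤x

≈-isEquivalence : IsEquivalence _≈_
≈-isEquivalence = record { refl = ≈-refl ; sym = ≈-sym ; trans = ≈-trans }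

≤-isPreorder : IsPreorder _≈_ _≤_
≤-isPreorder = record { isEquivalence = ≈-isEquivalence ; reflexive = proj₁ ; trans = ≤-trans }

≤-preorder : Preorder _ _ _
≤-preorder = record { isPreorder = ≤-isPreorder }

module ≤-Reasoning where
  open import Relation.Binary.Reasoning.Preorder ≤-preorder public

≤-succ : ∀ x → x ≤ succ x
≤-succ zero      = ≤-zero
≤-succ (succ x)  = ≤-succ-mono (≤-succ x)
≤-succ (limit f) = ≤-limiting (λ k → ≤-trans (≤-succ (f k)) (≤-succ-mono (≤-cocone k ≤-refl)))

succ-cong : ∀ {x y} → x ≈ y → succ x ≈ succ y
succ-cong (x≤y , y≤x) = ≤-succ-mono x≤y , ≤-succ-mono y≤x

limit-cong : ∀ {f g} → (∀ k → f k ≈ g k) → limit f ≈ limit g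
limit-cong f≈g = ≤-limiting (λ k → ≤-cocone k (proj₁ (f≈g k)))
               , ≤-limiting (λ k → ≤-cocone k (proj₂ (f≈g k)))

x≤x+y : ∀ x y → x ≤ x + y
x≤x+y x zero      = ≤-refl
x≤x+y x (succ y)  = ≤-trans (x≤x+y x y) (≤-succ _)
x≤x+y x (limit f) = ≤-cocone 0 (x≤x+y x (f 0))

y≤x+y : ∀ x y → y ≤ x + y
y≤x+y x zero      = ≤-zero
y≤x+y x (succ y)  = ≤-succ-mono (y≤x+y x y)
y≤x+y x (limit f) = ≤-limiting (λ k → ≤-cocone k (y≤x+y x (f k)))

+-identityˡ : ∀ x → zero + x ≈ x
+-identityˡ x = zero+x≤x x , y≤x+y zero x
  where
  zero+x≤x : ∀ x → zero + x ≤ x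
  zero+x≤x zero      = ≤-zero
  zero+x≤x (succ x)  = ≤-succ-mono (zero+x≤x x)
  zero+x≤x (limit f) = ≤-limiting (λ k → ≤-cocone k (zero+x≤x (f k)))

+-monoʳ-≤ : ∀ x {y y′} → y ≤ y′ → x + y ≤ x + y′
+-monoʳ-≤ x (≤-zero {y′})    = x≤x+y x y′
+-monoʳ-≤ x (≤-trans p q)    = ≤-trans (+-monoʳ-≤ x p) (+-monoʳ-≤ x q)
+-monoʳ-≤ x (≤-succ-mono p)  = ≤-succ-mono (+-monoʳ-≤ x p)
+-monoʳ-≤ x (≤-cocone k p)   = ≤-cocone k (+-monoʳ-≤ x p)
+-monoʳ-≤ x (≤-limiting p)   = ≤-limiting (λ k → +-monoʳ-≤ x (p k))

+-monoˡ-≤ : ∀ {x x′} y → x ≤ x′ → x + y ≤ x′ + y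
+-monoˡ-≤ zero      p = p
+-monoˡ-≤ (succ y)  p = ≤-succ-mono (+-monoˡ-≤ y p)
+-monoˡ-≤ (limit f) p = ≤-limiting (λ k → ≤-cocone k (+-monoˡ-≤ (f k) p))

+-mono-≤ : ∀ {x x′ y y′} → x ≤ x′ → y ≤ y′ → x + y ≤ x′ + y′
+-mono-≤ {x′ = x′} {y = y} p q = ≤-trans (+-monoˡ-≤ y p) (+-monoʳ-≤ x′ q)

+-cong : ∀ {x x′ y y′} → x ≈ x′ → y ≈ y′ → x + y ≈ x′ + y′
+-cong (p , p′) (q , q′) = +-mono-≤ p q , +-mono-≤ p′ q′

+-assoc : ∀ x y z → (x + y) + z ≈ x + (y + z)
+-assoc x y zero      = ≈-refl
+-assoc x y (succ z)  = succ-cong (+-assoc x y z)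
+-assoc x y (limit f) = limit-cong (λ k → +-assoc x y (f k))

*-monoʳ-≤ : ∀ x {y y′} → y ≤ y′ → x * y ≤ x * y′
*-monoʳ-≤ x ≤-zero          = ≤-zero
*-monoʳ-≤ x (≤-trans p q)   = ≤-trans (*-monoʳ-≤ x p) (*-monoʳ-≤ x q)
*-monoʳ-≤ x (≤-succ-mono p) = +-monoˡ-≤ x (*-monoʳ-≤ x p)
*-monoʳ-≤ x (≤-cocone k p)  = ≤-cocone k (*-monoʳ-≤ x p)
*-monoʳ-≤ x (≤-limiting p)  = ≤-limiting (λ k → *-monoʳ-≤ x (p k))

*-monoˡ-≤ : ∀ {x x′} y → x ≤ x′ → x * y ≤ x′ * y
*-monoˡ-≤ zero      p = ≤-zero
*-monoˡ-≤ (succ y)  p = +-mono-≤ (*-monoˡ-≤ y p) p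
*-monoˡ-≤ (limit f) p = ≤-limiting (λ k → ≤-cocone k (*-monoˡ-≤ (f k) p))

*-mono-≤ : ∀ {x x′ y y′} → x ≤ x′ → y ≤ y′ → x * y ≤ x′ * y′
*-mono-≤ {x′ = x′} {y = y} p q = ≤-trans (*-monoˡ-≤ y p) (*-monoʳ-≤ x′ q)

*-cong : ∀ {x x′ y y′} → x ≈ x′ → y ≈ y′ → x * y ≈ x′ * y′
*-cong (p , p′) (q , q′) = *-mono-≤ p q , *-mono-≤ p′ q′

*-zeroˡ : ∀ x → zero * x ≈ zero
*-zeroˡ zero      = ≈-refl
*-zeroˡ (succ x)  = *-zeroˡ x
*-zeroˡ (limit f) = ≤-limiting (λ k → proj₁ (*-zeroˡ (f k))) , ≤-zero

*-identityʳ : ∀ x → x * succ zero ≈ x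
*-identityʳ = +-identityˡ

*-distribˡ-+ : ∀ x y z → x * (y + z) ≈ x * y + x * z
*-distribˡ-+ x y zero      = ≈-refl
*-distribˡ-+ x y (succ z)  =
  ≈-trans (+-cong (*-distribˡ-+ x y z) (≈-refl {x})) (+-assoc (x * y) (x * z) x)
*-distribˡ-+ x y (limit f) = limit-cong (λ k → *-distribˡ-+ x y (f k))

*-assoc : ∀ x y z → (x * y) * z ≈ x * (y * z)
*-assoc x y zero      = ≈-refl
*-assoc x y (succ z)  =
  ≈-trans (+-cong (*-assoc x y z) (≈-refl {x * y})) (≈-sym (*-distribˡ-+ x (y * z) y))
*-assoc x y (limit f) = limit-cong (λ k → *-assoc x y (f k))

*-ι-suc : ∀ x n → x * ι (ℕ.suc n) ≈ x + x * ι n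
*-ι-suc x ℕ.zero    = +-identityˡ x
*-ι-suc x (ℕ.suc n) = ≈-trans (+-cong (*-ι-suc x n) (≈-refl {x})) (+-assoc x (x * ι n) x)

^-distribˡ-+-* : ∀ x y z → x ^ (y + z) ≈ x ^ y * x ^ z
^-distribˡ-+-* x y zero      = ≈-sym (*-identityʳ (x ^ y))
^-distribˡ-+-* x y (succ z)  =
  ≈-trans (*-cong (^-distribˡ-+-* x y z) (≈-refl {x})) (*-assoc (x ^ y) (x ^ z) x)
^-distribˡ-+-* x y (limit f) = limit-cong (λ k → ^-distribˡ-+-* x y (f k))

1≤ω^ : ∀ y → succ zero ≤ ω ^ y
1≤ω^ zero      = ≤-refl
1≤ω^ (succ y)  = ≤-cocone 1 (≤-trans (1≤ω^ y) (y≤x+y zero (ω ^ y)))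
1≤ω^ (limit f) = ≤-cocone 0 (1≤ω^ (f 0))

ω^-mono-≤ : ∀ {y y′} → y ≤ y′ → ω ^ y ≤ ω ^ y′
ω^-mono-≤ (≤-zero {y′})   = 1≤ω^ y′
ω^-mono-≤ (≤-trans p q)   = ≤-trans (ω^-mono-≤ p) (ω^-mono-≤ q)
ω^-mono-≤ (≤-succ-mono p) = *-monoˡ-≤ ω (ω^-mono-≤ p)
ω^-mono-≤ (≤-cocone k p)  = ≤-cocone k (ω^-mono-≤ p)
ω^-mono-≤ (≤-limiting p)  = ≤-limiting (λ k → ω^-mono-≤ (p k))

ω^-cong : ∀ {y y′} → y ≈ y′ → ω ^ y ≈ ω ^ y′
ω^-cong (p , p′) = ω^-mono-≤ p , ω^-mono-≤ p′

infix 4 _absorbedBy_ _≤″_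

_absorbedBy_ : Brw → Brw → Set
x absorbedBy y = x + y ≤ y

_≤″_ : Brw → Brw → Set
x ≤″ y = ∃[ z ] x + z ≈ y

≤″⇒≤ : ∀ {x y} → x ≤″ y → x ≤ y
≤″⇒≤ {x} (z , x+z≈y) = ≤-trans (x≤x+y x z) (proj₁ x+z≈y)

≤″-+ʳ : ∀ {x y} → x ≤″ y → ∀ w → x ≤″ y + w
≤″-+ʳ {x} (z , x+z≈y) w = z + w , ≈-trans (≈-sym (+-assoc x z w)) (+-cong x+z≈y ≈-refl)

absorbedBy⇒≤″ : ∀ {x y} → x absorbedBy y → x ≤″ y
absorbedBy⇒≤″ {x} {y} x+y≤y = y , x+y≤y , y≤x+y x y

absorbedBy-antiˡ : ∀ {x x′ y} → x′ ≤ x → x absorbedBy y → x′ absorbedBy y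
absorbedBy-antiˡ {y = y} x′≤x x+y≤y = ≤-trans (+-monoˡ-≤ y x′≤x) x+y≤y

absorbedBy-respʳ-≈ : ∀ {x y y′} → y ≈ y′ → x absorbedBy y → x absorbedBy y′
absorbedBy-respʳ-≈ {x} (y≤y′ , y′≤y) x+y≤y = ≤-trans (+-monoʳ-≤ x y′≤y) (≤-trans x+y≤y y≤y′)

absorbedBy-+ʳ : ∀ {x y} → x absorbedBy y → ∀ w → x absorbedBy y + w
absorbedBy-+ʳ {x} {y} x+y≤y w = ≤-trans (proj₂ (+-assoc x y w)) (+-monoˡ-≤ w x+y≤y)

absorbedBy-*ι : ∀ {x y} → x absorbedBy y → ∀ n → x * ι n absorbedBy y
absorbedBy-*ι {y = y} x+y≤y ℕ.zero    = proj₁ (+-identityˡ y)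
absorbedBy-*ι {x} {y} x+y≤y (ℕ.suc n) =
  ≤-trans (proj₁ (+-assoc (x * ι n) x y)) (≤-trans (+-monoʳ-≤ _ x+y≤y) (absorbedBy-*ι x+y≤y n))

absorbedBy-*ω-self : ∀ x → x absorbedBy x * ω
absorbedBy-*ω-self x = ≤-limiting (λ k → ≤-cocone (ℕ.suc k) (proj₂ (*-ι-suc x k)))

absorbedBy-*ω : ∀ {x y} → x absorbedBy y → x absorbedBy y * ω
absorbedBy-*ω {x} {y} x+y≤y = ≤-limiting (λ k → ≤-cocone (ℕ.suc k) (x+y*ι≤y*ι-suc k))
  where
  x+y*ι≤y*ι-suc : ∀ k → x + y * ι k ≤ y * ι (ℕ.suc k)
  x+y*ι≤y*ι-suc ℕ.zero    = ≤-trans (≤-trans (x≤x+y x y) x+y≤y) (y≤x+y zero y)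
  x+y*ι≤y*ι-suc (ℕ.suc k) = ≤-trans (proj₂ (+-assoc x (y * ι k) y)) (+-monoˡ-≤ y (x+y*ι≤y*ι-suc k))

absorbedBy-*ω^ : ∀ {x y} → x absorbedBy y → ∀ z → x absorbedBy y * ω ^ z
absorbedBy-*ω^ {y = y} x+y≤y zero      = absorbedBy-respʳ-≈ (≈-sym (*-identityʳ y)) x+y≤y
absorbedBy-*ω^ {y = y} x+y≤y (succ z)  =
  absorbedBy-respʳ-≈ (*-assoc y (ω ^ z) ω) (absorbedBy-*ω (absorbedBy-*ω^ x+y≤y z))
absorbedBy-*ω^         x+y≤y (limit f) = ≤-limiting (λ k → ≤-cocone k (absorbedBy-*ω^ x+y≤y (f k)))

ω^-absorbedBy : ∀ {a b} → succ a ≤″ b → ω ^ a absorbedBy ω ^ b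
ω^-absorbedBy {a} {b} (z , 1+a+z≈b) =
  absorbedBy-respʳ-≈ ω^[1+a]*ω^z≈ω^b (absorbedBy-*ω^ (absorbedBy-*ω-self (ω ^ a)) z)
  where
  ω^[1+a]*ω^z≈ω^b : ω ^ succ a * ω ^ z ≈ ω ^ b
  ω^[1+a]*ω^z≈ω^b = ≈-trans (≈-sym (^-distribˡ-+-* ω (succ a) z)) (ω^-cong 1+a+z≈b)

-- Only for images of CtoB: for a limit y it is undecidable whether ω ^ y is 1 or absorbs 1.
1≤″ω^CtoB : ∀ t → succ zero ≤″ ω ^ CtoB t
1≤″ω^CtoB 𝟎          = zero , ≈-refl
1≤″ω^CtoB (ω^ c + d) = absorbedBy⇒≤″ (ω^-absorbedBy (≤″-+ʳ (1≤″ω^CtoB c) (CtoB d)))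

ι-+-homo : ∀ m n → ι m + ι n ≡ ι (n ℕ.+ m)
ι-+-homo m ℕ.zero    = refl
ι-+-homo m (ℕ.suc n) = cong succ (ι-+-homo m n)

ι-*-homo : ∀ m n → ι m * ι n ≡ ι (n ℕ.* m)
ι-*-homo m ℕ.zero    = refl
ι-*-homo m (ℕ.suc n) = trans (cong (_+ ι m) (ι-*-homo m n)) (ι-+-homo (n ℕ.* m) m)

ι*ω^1≤ω^1 : ∀ n → ι n * ω ^ succ zero ≤ ω ^ succ zero
ι*ω^1≤ω^1 n = ≤-limiting λ k →
  ≤-cocone (k ℕ.* n) (≤-reflexive (trans (cong (ι n *_) (1*ι k))
                                         (trans (ι-*-homo n k) (sym (1*ι (k ℕ.* n))))))
  where
  1*ι : ∀ k → succ zero * ι k ≡ ι k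
  1*ι ℕ.zero    = refl
  1*ι (ℕ.suc k) = cong succ (1*ι k)

ι*ω^-≤ : ∀ n {B} → succ zero ≤″ B → ι n * ω ^ B ≤ ω ^ B
ι*ω^-≤ n {B} (Z , 1+Z≈B) = begin
  ι n * ω ^ B                      ≈⟨ *-cong ≈-refl ω^B≈ω^1*ω^Z ⟩
  ι n * (ω ^ succ zero * ω ^ Z)    ≈⟨ *-assoc (ι n) (ω ^ succ zero) (ω ^ Z) ⟨
  (ι n * ω ^ succ zero) * ω ^ Z    ≲⟨ *-monoˡ-≤ (ω ^ Z) (ι*ω^1≤ω^1 n) ⟩
  ω ^ succ zero * ω ^ Z            ≈⟨ ω^B≈ω^1*ω^Z ⟨
  ω ^ B                            ∎
  where
  open ≤-Reasoning
  ω^B≈ω^1*ω^Z : ω ^ B ≈ ω ^ succ zero * ω ^ Z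
  ω^B≈ω^1*ω^Z = ≈-trans (ω^-cong (≈-sym 1+Z≈B)) (^-distribˡ-+-* ω (succ zero) Z)

CtoB-<⇒≤″ : ∀ {a b} → isCnf a → isCnf b → a <ᵀ b → succ (CtoB a) ≤″ CtoB b
CtoB-bounded : ∀ {a c} → isCnf c → left c ≤ᵀ a → isCnf a →
               ∃[ n ] CtoB c ≤ ω ^ CtoB a * ι n
CtoB-mono-≤ : ∀ {a b} → isCnf a → isCnf b → a ≤ᵀ b → CtoB a ≤ CtoB b
succ-CtoB-absorbedBy : ∀ {a c b} → isCnf (ω^ a + c) → succ (CtoB a) ≤″ b →
                       succ (CtoB (ω^ a + c)) absorbedBy ω ^ b

CtoB-<⇒≤″ cnf𝟎 (cnfω {b} {d} _ _ _) <₁ = ≤″-+ʳ (1≤″ω^CtoB b) (CtoB d)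
CtoB-<⇒≤″ ca@(cnfω ca₁ _ _) (cnfω {b} {d} cb₁ _ _) (<₂ a₁<b₁) =
  absorbedBy⇒≤″ (absorbedBy-+ʳ (succ-CtoB-absorbedBy ca (CtoB-<⇒≤″ ca₁ cb₁ a₁<b₁)) (CtoB d))
CtoB-<⇒≤″ (cnfω {a} {c} _ cc _) (cnfω _ cd _) (<₃ refl c<d) with CtoB-<⇒≤″ cc cd c<d
... | z , 1+c+z≈d = z , ≈-trans (+-assoc (ω ^ CtoB a) (succ (CtoB c)) z) (+-cong ≈-refl 1+c+z≈d)

CtoB-bounded cnf𝟎 _ _ = 0 , ≤-zero
CtoB-bounded {a} (cnfω {a′} {c′} ca′ cc′ left-c′≤a′) a′≤a ca with CtoB-bounded cc′ left-c′≤a′ ca′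
... | m , c′≤ω^a′*m = ℕ.suc m , (begin
  ω ^ CtoB a′ + CtoB c′           ≲⟨ +-monoʳ-≤ (ω ^ CtoB a′) c′≤ω^a′*m ⟩
  ω ^ CtoB a′ + ω ^ CtoB a′ * ι m ≈⟨ *-ι-suc (ω ^ CtoB a′) m ⟨
  ω ^ CtoB a′ * ι (ℕ.suc m)       ≲⟨ *-monoˡ-≤ (ι (ℕ.suc m)) (ω^-mono-≤ (CtoB-mono-≤ ca′ ca a′≤a)) ⟩
  ω ^ CtoB a * ι (ℕ.suc m)        ∎)
  where open ≤-Reasoning

CtoB-mono-≤ _  _  (inj₂ refl) = ≤-refl
CtoB-mono-≤ ca cb (inj₁ a<b)  = ≤-trans (≤-succ _) (≤″⇒≤ (CtoB-<⇒≤″ ca cb a<b))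

succ-CtoB-absorbedBy {a} {c} ca@(cnfω ca₁ _ _) 1+a≤″b with CtoB-bounded ca (inj₂ refl) ca₁
... | n , x≤ω^a*n = absorbedBy-antiˡ succ-x≤ (absorbedBy-*ι (ω^-absorbedBy 1+a≤″b) (ℕ.suc n))
  where
  succ-x≤ : succ (CtoB (ω^ a + c)) ≤ ω ^ CtoB a * ι (ℕ.suc n)
  succ-x≤ = +-mono-≤ x≤ω^a*n (1≤ω^ (CtoB a))

<ᵀ-or-≥ᵀ : ∀ a b → a <ᵀ b ⊎ b ≤ᵀ a
<ᵀ-or-≥ᵀ 𝟎          𝟎          = inj₂ (inj₂ refl)
<ᵀ-or-≥ᵀ 𝟎          (ω^ _ + _) = inj₁ <₁
<ᵀ-or-≥ᵀ (ω^ _ + _) 𝟎          = inj₂ (inj₁ <₁)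
<ᵀ-or-≥ᵀ (ω^ a + b) (ω^ c + d) with <ᵀ-or-≥ᵀ a c
... | inj₁ a<c        = inj₁ (<₂ a<c)
... | inj₂ (inj₁ c<a) = inj₂ (inj₁ (<₂ c<a))
... | inj₂ (inj₂ refl) with <ᵀ-or-≥ᵀ b d
...   | inj₁ b<d        = inj₁ (<₃ refl b<d)
...   | inj₂ (inj₁ d<b) = inj₂ (inj₁ (<₃ refl d<b))
...   | inj₂ (inj₂ refl) = inj₂ (inj₂ refl)

≮ᵀ⇒≥ᵀ : ∀ {a b} → ¬ (a <ᵀ b) → b ≤ᵀ a
≮ᵀ⇒≥ᵀ {a} {b} a≮b with <ᵀ-or-≥ᵀ a b
... | inj₁ a<b = ⊥-elim (a≮b a<b)
... | inj₂ b≤a = b≤a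

left-⊕ : ∀ x y → left (x ⊕ y) ≡ left x ⊎ left (x ⊕ y) ≡ left y
left-⊕ 𝟎          y          = inj₂ refl
left-⊕ (ω^ a + c) 𝟎          = inj₁ refl
left-⊕ (ω^ a + c) (ω^ b + d) with a <ᵀ? b
... | yes _ = inj₂ refl
... | no  _ = inj₁ refl

⊕-isCnf : ∀ {x y} → isCnf x → isCnf y → isCnf (x ⊕ y)
⊕-isCnf cnf𝟎               cy   = cy
⊕-isCnf cx@(cnfω _ _ _)    cnf𝟎 = cx
⊕-isCnf (cnfω {a} {c} ca cc c≤a) cy@(cnfω {b} {d} _ _ _) with a <ᵀ? b
... | yes _   = cy
... | no  a≮b = cnfω ca (⊕-isCnf cc cy) (left-bounded (left-⊕ c (ω^ b + d)))
  where
  left-bounded : left (c ⊕ (ω^ b + d)) ≡ left c ⊎ left (c ⊕ (ω^ b + d)) ≡ b →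
                 left (c ⊕ (ω^ b + d)) ≤ᵀ a
  left-bounded (inj₁ e) = subst (_≤ᵀ a) (sym e) c≤a
  left-bounded (inj₂ e) = subst (_≤ᵀ a) (sym e) (≮ᵀ⇒≥ᵀ a≮b)

ω^ᶜ-isCnf : ∀ {a} → isCnf a → isCnf (ω^ᶜ a)
ω^ᶜ-isCnf {𝟎}        ca = cnfω ca cnf𝟎 (inj₂ refl)
ω^ᶜ-isCnf {ω^ _ + _} ca = cnfω ca cnf𝟎 (inj₁ <₁)

⊗-isCnf : ∀ {x y} → isCnf x → isCnf y → isCnf (x ⊗ y)
⊗-isCnf cnf𝟎 _ = cnf𝟎
⊗-isCnf (cnfω _ _ _) cnf𝟎 = cnf𝟎
⊗-isCnf cx@(cnfω _ _ _)  (cnfω {𝟎}        _  cd _) = ⊕-isCnf cx (⊗-isCnf cx cd)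
⊗-isCnf cx@(cnfω ca _ _) (cnfω {ω^ _ + _} cb cd _) =
  ⊕-isCnf (ω^ᶜ-isCnf (⊕-isCnf ca cb)) (⊗-isCnf cx cd)

CtoB-⊕ : ∀ {x y} → isCnf x → isCnf y → CtoB (x ⊕ y) ≈ CtoB x + CtoB y
CtoB-⊕ {y = y} cnf𝟎 _ = ≈-sym (+-identityˡ (CtoB y))
CtoB-⊕ (cnfω _ _ _) cnf𝟎 = ≈-refl
CtoB-⊕ cx@(cnfω {a} {c} ca cc _) cy@(cnfω {b} {d} cb _ _) with a <ᵀ? b
... | yes a<b = y≤x+y (CtoB (ω^ a + c)) (CtoB (ω^ b + d)) , x+y≤y
  where
  succ-x-absorbed : succ (CtoB (ω^ a + c)) absorbedBy ω ^ CtoB b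
  succ-x-absorbed = succ-CtoB-absorbedBy cx (CtoB-<⇒≤″ ca cb a<b)
  x+y≤y : CtoB (ω^ a + c) absorbedBy CtoB (ω^ b + d)
  x+y≤y = absorbedBy-+ʳ (absorbedBy-antiˡ (≤-succ _) succ-x-absorbed) (CtoB d)
... | no  _   = ≈-trans (+-cong (≈-refl {ω ^ CtoB a}) (CtoB-⊕ cc cy))
                        (≈-sym (+-assoc (ω ^ CtoB a) (CtoB c) (CtoB (ω^ b + d))))

CtoB-*-ω^ : ∀ {a c b} → isCnf (ω^ a + c) → succ zero ≤″ b →
            CtoB (ω^ a + c) * ω ^ b ≈ ω ^ (CtoB a + b)
CtoB-*-ω^ {a} {c} {b} cx@(cnfω ca _ _) 1≤″b with CtoB-bounded cx (inj₂ refl) ca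
... | n , x≤ω^a*n = x*ω^b≤ , ω^[a+b]≤
  where
  open ≤-Reasoning
  x*ω^b≤ : CtoB (ω^ a + c) * ω ^ b ≤ ω ^ (CtoB a + b)
  x*ω^b≤ = begin
    CtoB (ω^ a + c) * ω ^ b    ≲⟨ *-monoˡ-≤ (ω ^ b) x≤ω^a*n ⟩
    ω ^ CtoB a * ι n * ω ^ b   ≈⟨ *-assoc (ω ^ CtoB a) (ι n) (ω ^ b) ⟩
    ω ^ CtoB a * (ι n * ω ^ b) ≲⟨ *-monoʳ-≤ (ω ^ CtoB a) (ι*ω^-≤ n 1≤″b) ⟩
    ω ^ CtoB a * ω ^ b         ≈⟨ ^-distribˡ-+-* ω (CtoB a) b ⟨
    ω ^ (CtoB a + b)           ∎
  ω^[a+b]≤ : ω ^ (CtoB a + b) ≤ CtoB (ω^ a + c) * ω ^ b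
  ω^[a+b]≤ = begin
    ω ^ (CtoB a + b)           ≈⟨ ^-distribˡ-+-* ω (CtoB a) b ⟩
    ω ^ CtoB a * ω ^ b         ≲⟨ *-monoˡ-≤ (ω ^ b) (x≤x+y (ω ^ CtoB a) (CtoB c)) ⟩
    CtoB (ω^ a + c) * ω ^ b    ∎

CtoB-⊗ : ∀ {x y} → isCnf x → isCnf y → CtoB (x ⊗ y) ≈ CtoB x * CtoB y
CtoB-⊗ {y = y} cnf𝟎 _ = ≈-sym (*-zeroˡ (CtoB y))
CtoB-⊗ (cnfω _ _ _) cnf𝟎 = ≈-refl
CtoB-⊗ {x} cx@(cnfω _ _ _) (cnfω {𝟎} {d} _ cd _) = begin-equality
  CtoB (x ⊕ x ⊗ d)                     ≈⟨ CtoB-⊕ cx (⊗-isCnf cx cd) ⟩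
  CtoB x + CtoB (x ⊗ d)                ≈⟨ +-cong (≈-sym (*-identityʳ (CtoB x))) (CtoB-⊗ cx cd) ⟩
  CtoB x * succ zero + CtoB x * CtoB d ≈⟨ *-distribˡ-+ (CtoB x) (succ zero) (CtoB d) ⟨
  CtoB x * (succ zero + CtoB d)        ∎
  where open ≤-Reasoning
CtoB-⊗ {x} cx@(cnfω {a} ca _ _) (cnfω {b@(ω^ _ + _)} {d} cb cd _) = begin-equality
  CtoB (ω^ᶜ (a ⊕ b) ⊕ x ⊗ d)              ≈⟨ CtoB-⊕ (ω^ᶜ-isCnf (⊕-isCnf ca cb)) (⊗-isCnf cx cd) ⟩
  ω ^ CtoB (a ⊕ b) + CtoB (x ⊗ d)         ≈⟨ +-cong (ω^-cong (CtoB-⊕ ca cb)) (CtoB-⊗ cx cd) ⟩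
  ω ^ (CtoB a + CtoB b) + CtoB x * CtoB d ≈⟨ +-cong (CtoB-*-ω^ cx 1≤″b) ≈-refl ⟨
  CtoB x * ω ^ CtoB b + CtoB x * CtoB d   ≈⟨ *-distribˡ-+ (CtoB x) (ω ^ CtoB b) (CtoB d) ⟨
  CtoB x * (ω ^ CtoB b + CtoB d)          ∎
  where
  open ≤-Reasoning
  1≤″b : succ zero ≤″ CtoB b
  1≤″b = CtoB-<⇒≤″ cnf𝟎 cb <₁

theorem8p4 : ((a b : Cnf) → CtoB (proj₁ a ⊕ proj₁ b) ≈ CtoB (proj₁ a) + CtoB (proj₁ b))
    × ((a b : Cnf) → CtoB (proj₁ a ⊗ proj₁ b) ≈ CtoB (proj₁ a) * CtoB (proj₁ b))
    × ((a : Cnf) → CtoB (ω^ᶜ (proj₁ a)) ≈ ω ^ CtoB (proj₁ a))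
theorem8p4 = (λ a b → CtoB-⊕ (proj₂ a) (proj₂ b))
           , (λ a b → CtoB-⊗ (proj₂ a) (proj₂ b))
           , (λ a → ≈-refl)
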